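{- Let $r\geq 3$, $t\geq 1$ and $n,k$ be positive integers with $n\geq 2k$. Then \[ m(n,k,r,t)\leq\alpha_r^t\binom{n}{k}, \] where $\alpha_r$ is the unique root of $x=\frac12+\frac12x^r$ in the open interval $(0,1)$.
   Context: $\binom{[n]}{k}$ is the set of $k$-subsets of $[n]=\{1,\dots,n\}$. A family $\mathcal{F}$ is $r$-wise $t$-intersecting if $|F_1\cap\dots\cap F_r|\geq t$ for all (not necessarily distinct) $F_1,\dots,F_r\in\mathcal{F}$. $m(n,k,r,t)$ is the maximum of $|\mathcal{F}|$ over all $r$-wise $t$-intersecting families $\mathcal{F}\subset\binom{[n]}{k}$. -}

module Defs where

open import Data.Nat as ℕ using (ℕ; zero; suc; _≤_)
open import Data.Integer using (+_)
open import Data.Rational as ℚ using (ℚ; _/_; 0ℚ; 1ℚ)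
open import Data.Fin using (Fin)
open import Data.Fin.Subset using (Subset; ⋂; ∣_∣)
open import Data.List using (List; tabulate)
open import Data.List.Membership.Propositional using (_∈_)
open import Data.List.Relation.Unary.All using (All)
open import Data.List.Relation.Unary.Unique.Propositional using (Unique)
open import Data.Product using (_×_)

ℕ→ℚ : ℕ → ℚ
ℕ→ℚ m = + m / 1

_^ℚ_ : ℚ → ℕ → ℚ
q ^ℚ zero  = 1ℚ
q ^ℚ suc m = q ℚ.* (q ^ℚ m)

IsKFamily : (n k : ℕ) → List (Subset n) → Set
IsKFamily n k F = Unique F × All (λ A → ∣ A ∣ ≡ k) F
  where open import Relation.Binary.PropositionalEquality using (_≡_)

-- r-wise t-intersecting: any r (not necessarily distinct) members
-- F₁,…,Fᵣ of the family satisfy |F₁ ∩ … ∩ Fᵣ| ≥ t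
RWiseTIntersecting : {n : ℕ} (r t : ℕ) → List (Subset n) → Set
RWiseTIntersecting r t F =
  (G : Fin r → Subset _) → (∀ i → G i ∈ F) → t ≤ ∣ ⋂ (tabulate G) ∣

module Submission where

-- Shift the family towards the point 0 along every other point b (replace b by 0 in a member
-- unless the result is already a member).  Shifting keeps the size, the uniformity and the
-- r-wise t-intersection property, and after shifting along every b the family is stable:
-- replacing by 0 a point of a member avoiding 0 gives a member.  In a stable family the
-- members through 0, with 0 deleted, are r-wise (t − 1)-intersecting, and the members
-- avoiding 0 are r-wise (t + r − 1)-intersecting: among r of them, r − 1 common points can be
-- traded for 0, one member at a time, and each trade removes one common point.  So |F| is at most
-- the number walkBound r n k t produced by this recursion.
-- Weight a state reached after i steps avoiding 0 and j steps through 0 by 2^(i + j).  Each state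
-- is the average of its two successors, with requirements t − 1 and t + r − 1, so 1 + q^r < 2q
-- gains a factor q per step.  When the requirement reaches 0 we have j ≥ 2i + 1, and for n ≥ 2k
-- then 2^(i + j) C(m, k − j) ≤ C(n, k): a step through 0 at least doubles the binomial
-- coefficient, and one avoiding step with two steps through 0 multiplies it by at least 8.

module SetSystems where

  open import Data.Bool as Bool using ()
  open import Data.Nat using (ℕ; zero; suc; _+_; _≤_; _<_; s≤s; z≤n)
  open import Data.Nat.Properties using (≤-refl; ≤-trans; ≤-reflexive; +-identityʳ; +-suc; <⇒≤; <-irrefl; m≤n⇒m≤1+n; module ≤-Reasoning)
  open import Data.Fin using (Fin; zero; suc; toℕ; fromℕ<; _≟_)
  open import Data.Fin.Properties using (¬∀⟶∃¬; toℕ-fromℕ<)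
  open import Data.Fin.Subset using (Subset; inside; outside; ⋂; ∣_∣; _⊆_; _⊂_; Nonempty) renaming (_∈_ to _∈ₛ_; _∉_ to _∉ₛ_)
  open import Data.Fin.Subset.Properties using (x∈p∩q⁺; x∈p∩q⁻; ∈⊤; p⊆q⇒∣p∣≤∣q∣; p⊂q⇒∣p∣<∣q∣; nonempty?; Empty-unique; ∣⊥∣≡0) renaming (_∈?_ to _∈ₛ?_)
  open import Data.Vec using (_∷_; lookup; _[_]≔_; here; there)
  open import Data.Vec.Properties using (≡-dec; []≔-updates; []≔-minimal; []≔-idempotent; []≔-commutes; []≔-lookup; []=⇒lookup; lookup⇒[]=; lookup∘updateAt′)
  open import Data.Vec.Functional using (updateAt)
  open import Data.Vec.Functional.Properties using (updateAt-updates; updateAt-minimal)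
  open import Data.List using (List; []; _∷_; map; tabulate; length)
  open import Data.List.Properties using (length-map)
  open import Data.List.Membership.Propositional using (_∈_; _∉_)
  open import Data.List.Membership.Propositional.Properties using (∈-map⁻; ∈-map⁺)
  open import Data.List.Relation.Unary.Any using (here; there)
  open import Data.List.Relation.Unary.All using (All)
  import Data.List.Relation.Unary.All as All
  import Data.List.Relation.Unary.All.Properties as All
  open import Data.List.Relation.Unary.AllPairs using ([]; _∷_)
  open import Data.List.Relation.Unary.Unique.Propositional using (Unique)
  open import Data.Product using (∃-syntax; _×_; _,_; proj₁; proj₂)
  open import Function using (_∘_)
  open import Relation.Binary.PropositionalEquality
  open import Relation.Nullary using (yes; no; contradiction)
  open import Defs

  private variable
    n r : ℕ
    p : Subset n
    x y a b : Fin n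

  ∈⋂⁺ : ∀ {B : Fin r → Subset n} → (∀ i → x ∈ₛ B i) → x ∈ₛ ⋂ (tabulate B)
  ∈⋂⁺ {r = zero}  _   = ∈⊤
  ∈⋂⁺ {r = suc r} x∈B = x∈p∩q⁺ (x∈B zero , ∈⋂⁺ (x∈B ∘ suc))

  ∈⋂⁻ : ∀ (B : Fin r → Subset n) → x ∈ₛ ⋂ (tabulate B) → ∀ i → x ∈ₛ B i
  ∈⋂⁻ B x∈⋂ zero    = proj₁ (x∈p∩q⁻ (B zero) _ x∈⋂)
  ∈⋂⁻ B x∈⋂ (suc i) = ∈⋂⁻ (B ∘ suc) (proj₂ (x∈p∩q⁻ (B zero) _ x∈⋂)) i

  ∈-[]≔⁻ : ∀ {s} → x ≢ y → x ∈ₛ p [ y ]≔ s → x ∈ₛ p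
  ∈-[]≔⁻ {x = x} {y} {p} x≢y x∈ = lookup⇒[]= x p (trans (sym (lookup∘updateAt′ x y x≢y p)) ([]=⇒lookup x∈))

  ∉⇒lookup≡outside : x ∉ₛ p → lookup p x ≡ outside
  ∉⇒lookup≡outside {x = x} {p} x∉p with lookup p x in eq
  ... | outside = refl
  ... | inside  = contradiction (lookup⇒[]= x p eq) x∉p

  ∣p[x]≔outside∣ : x ∈ₛ p → suc ∣ p [ x ]≔ outside ∣ ≡ ∣ p ∣
  ∣p[x]≔outside∣                      here         = refl
  ∣p[x]≔outside∣ {p = inside  ∷ _} (there x∈p) = cong suc (∣p[x]≔outside∣ x∈p)
  ∣p[x]≔outside∣ {p = outside ∷ _} (there x∈p) = ∣p[x]≔outside∣ x∈p

  ∣p[x]≔inside∣ : x ∉ₛ p → ∣ p [ x ]≔ inside ∣ ≡ suc ∣ p ∣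
  ∣p[x]≔inside∣ {x = zero}  {inside  ∷ _} x∉p = contradiction here x∉p
  ∣p[x]≔inside∣ {x = zero}  {outside ∷ _} x∉p = refl
  ∣p[x]≔inside∣ {x = suc x} {inside  ∷ _} x∉p = cong suc (∣p[x]≔inside∣ (x∉p ∘ there))
  ∣p[x]≔inside∣ {x = suc x} {outside ∷ _} x∉p = ∣p[x]≔inside∣ (x∉p ∘ there)

  infixl 6 _[_↦_]

  _[_↦_] : Subset n → Fin n → Fin n → Subset n
  p [ b ↦ a ] = p [ b ]≔ outside [ a ]≔ inside

  a∈p[b↦a] : ∀ (p : Subset n) → a ∈ₛ p [ b ↦ a ]
  a∈p[b↦a] p = []≔-updates _ _

  b∉p[b↦a] : a ≢ b → b ∉ₛ p [ b ↦ a ]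
  b∉p[b↦a] {a = a} {b} {p} a≢b b∈ with () ← trans (sym ([]=⇒lookup ([]≔-updates p b))) ([]=⇒lookup (∈-[]≔⁻ (a≢b ∘ sym) b∈))

  ∈-[↦]⁺ : y ≢ b → y ∈ₛ p → y ∈ₛ p [ b ↦ a ]
  ∈-[↦]⁺ {y = y} {a = a} y≢b y∈p with y ≟ a
  ... | yes refl = a∈p[b↦a] _
  ... | no  y≢a  = []≔-minimal _ y _ y≢a ([]≔-minimal _ y _ y≢b y∈p)

  ∈-[↦]⁻ : y ≢ a → y ∈ₛ p [ b ↦ a ] → y ∈ₛ p
  ∈-[↦]⁻ {y = y} {b = b} y≢a y∈ with y ≟ b
  ... | yes refl = contradiction y∈ (b∉p[b↦a] (y≢a ∘ sym))
  ... | no  y≢b  = ∈-[]≔⁻ y≢b (∈-[]≔⁻ y≢a y∈)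

  ∉∈⇒≢ : a ∉ₛ p → b ∈ₛ p → a ≢ b
  ∉∈⇒≢ a∉p b∈p refl = a∉p b∈p

  ∣p[b↦a]∣ : a ∉ₛ p → b ∈ₛ p → ∣ p [ b ↦ a ] ∣ ≡ ∣ p ∣
  ∣p[b↦a]∣ a∉p b∈p = trans (∣p[x]≔inside∣ (a∉p ∘ ∈-[]≔⁻ (∉∈⇒≢ a∉p b∈p))) (∣p[x]≔outside∣ b∈p)

  p[b↦a][a↦b] : a ∉ₛ p → b ∈ₛ p → p [ b ↦ a ] [ a ↦ b ] ≡ p
  p[b↦a][a↦b] {a = a} {p} {b} a∉p b∈p = begin
    p [ b ]≔ outside [ a ]≔ inside [ a ]≔ outside [ b ]≔ inside  ≡⟨ cong (_[ b ]≔ inside) ([]≔-idempotent (p [ b ]≔ outside) a) ⟩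
    p [ b ]≔ outside [ a ]≔ outside [ b ]≔ inside                 ≡⟨ cong (_[ b ]≔ inside) ([]≔-commutes p b a (∉∈⇒≢ a∉p b∈p ∘ sym)) ⟩
    p [ a ]≔ outside [ b ]≔ outside [ b ]≔ inside                 ≡⟨ []≔-idempotent (p [ a ]≔ outside) b ⟩
    p [ a ]≔ outside [ b ]≔ inside                                ≡⟨ cong (λ s → p [ a ]≔ s [ b ]≔ inside) (∉⇒lookup≡outside a∉p) ⟨
    p [ a ]≔ lookup p a [ b ]≔ inside                             ≡⟨ cong (_[ b ]≔ inside) ([]≔-lookup p a) ⟩
    p [ b ]≔ inside                                               ≡⟨ cong (p [ b ]≔_) ([]=⇒lookup b∈p) ⟨
    p [ b ]≔ lookup p b                                           ≡⟨ []≔-lookup p b ⟩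
    p                                                             ∎
    where open ≡-Reasoning

  Unique-map⁺-on : ∀ {A B : Set} {f : A → B} {xs : List A} →
                   (∀ {x y} → x ∈ xs → y ∈ xs → f x ≡ f y → x ≡ y) → Unique xs → Unique (map f xs)
  Unique-map⁺-on {xs = []}     _   []         = []
  Unique-map⁺-on {xs = x ∷ xs} inj (x∉xs ∷ u) =
    All.map⁺ (All.tabulate (λ y∈xs fx≡fy → All.lookup x∉xs y∈xs (inj (here refl) (there y∈xs) fx≡fy)))
    ∷ Unique-map⁺-on (λ x∈ y∈ → inj (there x∈) (there y∈)) u

  module _ {a y : Fin n} (A : Fin r → Subset n) (j : Fin r) where

    ∈-updateAt-↦⁻ : ∀ {z} i → z ≢ a → z ∈ₛ updateAt A j (_[ y ↦ a ]) i → z ∈ₛ A i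
    ∈-updateAt-↦⁻ i z≢a z∈ with i ≟ j
    ... | yes refl = ∈-[↦]⁻ z≢a (subst (_ ∈ₛ_) (updateAt-updates j A) z∈)
    ... | no  i≢j  = subst (_ ∈ₛ_) (updateAt-minimal i j A i≢j) z∈

    ⋂-updateAt-↦ : a ∉ₛ ⋂ (tabulate (updateAt A j (_[ y ↦ a ]))) →
                   ⋂ (tabulate (updateAt A j (_[ y ↦ a ]))) ⊆ ⋂ (tabulate A)
    ⋂-updateAt-↦ a∉⋂ z∈⋂ = ∈⋂⁺ (λ i → ∈-updateAt-↦⁻ i (λ { refl → a∉⋂ z∈⋂ }) (∈⋂⁻ _ z∈⋂ i))

    y∉⋂-updateAt-↦ : a ≢ y → y ∉ₛ ⋂ (tabulate (updateAt A j (_[ y ↦ a ])))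
    y∉⋂-updateAt-↦ a≢y y∈⋂ = b∉p[b↦a] a≢y (subst (_ ∈ₛ_) (updateAt-updates j A) (∈⋂⁻ _ y∈⋂ j))

  Stable : Fin n → Fin n → List (Subset n) → Set
  Stable a b G = ∀ {P} → P ∈ G → a ∉ₛ P → b ∈ₛ P → P [ b ↦ a ] ∈ G

  module Shifting {n} (a b : Fin n) (G : List (Subset n)) where

    open import Data.List.Membership.DecPropositional (≡-dec {n = n} Bool._≟_) using () renaming (_∈?_ to _∈ₗ?_)

    shiftMember : Subset n → Subset n
    shiftMember P with a ∈ₛ? P | b ∈ₛ? P | P [ b ↦ a ] ∈ₗ? G
    ... | no _ | yes _ | no _ = P [ b ↦ a ]
    ... | _    | _     | _    = P

    shifted : List (Subset n)
    shifted = map shiftMember G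

    infix 4 _⇝_

    data _⇝_ (P : Subset n) : Subset n → Set where
      kept  : (a ∉ₛ P → b ∈ₛ P → P [ b ↦ a ] ∈ G) → P ⇝ P
      moved : a ∉ₛ P → b ∈ₛ P → P [ b ↦ a ] ∉ G → P ⇝ P [ b ↦ a ]

    ⇝shiftMember : ∀ P → P ⇝ shiftMember P
    ⇝shiftMember P with a ∈ₛ? P | b ∈ₛ? P | P [ b ↦ a ] ∈ₗ? G
    ... | no a∉P | yes b∈P | no moved∉G = moved a∉P b∈P moved∉G
    ... | yes a∈P | _       | _          = kept (λ a∉P _ → contradiction a∈P a∉P)
    ... | no _    | no b∉P  | _          = kept (λ _ b∈P → contradiction b∈P b∉P)
    ... | no _    | yes _   | yes moved∈G = kept (λ _ _ → moved∈G)

    ∈-shifted⁻ : ∀ {Q} → Q ∈ shifted → ∃[ P ] P ∈ G × P ⇝ Q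
    ∈-shifted⁻ Q∈ with P , P∈G , refl ← ∈-map⁻ shiftMember Q∈ = P , P∈G , ⇝shiftMember P

    ⇝-∣∣ : ∀ {P Q} → P ⇝ Q → ∣ Q ∣ ≡ ∣ P ∣
    ⇝-∣∣ (kept _)          = refl
    ⇝-∣∣ (moved a∉P b∈P _) = ∣p[b↦a]∣ a∉P b∈P

    ⇝-∈⁺ : ∀ {P Q y} → P ⇝ Q → y ≢ b → y ∈ₛ P → y ∈ₛ Q
    ⇝-∈⁺ (kept _)      _   y∈P = y∈P
    ⇝-∈⁺ (moved _ _ _) y≢b y∈P = ∈-[↦]⁺ y≢b y∈P

    ⇝-a∈ : ∀ {P Q} → P ⇝ Q → a ∈ₛ P → Q ≡ P
    ⇝-a∈ (kept _)          _   = refl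
    ⇝-a∈ (moved a∉P _ _) a∈P = contradiction a∈P a∉P

    ⇝-a∉ : ∀ {P Q} → P ⇝ Q → a ∉ₛ Q → Q ≡ P × (a ∉ₛ P → b ∈ₛ P → P [ b ↦ a ] ∈ G)
    ⇝-a∉ (kept stable)   _   = refl , stable
    ⇝-a∉ (moved _ _ _)   a∉Q = contradiction (a∈p[b↦a] _) a∉Q

    ⇝-b∉ : ∀ {P Q} → P ⇝ Q → b ∈ₛ P → b ∉ₛ Q → a ∉ₛ P × a ∈ₛ Q
    ⇝-b∉ (kept _)        b∈P b∉Q = contradiction b∈P b∉Q
    ⇝-b∉ (moved a∉P _ _) _   _   = a∉P , a∈p[b↦a] _

    ⇝-injective : ∀ {P P′ Q Q′} → P ∈ G → P′ ∈ G → P ⇝ Q → P′ ⇝ Q′ → Q ≡ Q′ → P ≡ P′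
    ⇝-injective _   _    (kept _)              (kept _)                Q≡Q′ = Q≡Q′
    ⇝-injective P∈G _    (kept _)              (moved _ _ moved∉G)     Q≡Q′ = contradiction (subst (_∈ G) Q≡Q′ P∈G) moved∉G
    ⇝-injective _   P′∈G (moved _ _ moved∉G)   (kept _)                Q≡Q′ = contradiction (subst (_∈ G) (sym Q≡Q′) P′∈G) moved∉G
    ⇝-injective _   _    (moved a∉P b∈P _)     (moved a∉P′ b∈P′ _)     Q≡Q′ =
      trans (sym (p[b↦a][a↦b] a∉P b∈P)) (trans (cong (_[ a ↦ b ]) Q≡Q′) (p[b↦a][a↦b] a∉P′ b∈P′))

    length-shifted : length shifted ≡ length G
    length-shifted = length-map shiftMember G

    shifted-unique : Unique G → Unique shifted
    shifted-unique = Unique-map⁺-on (λ P∈G P′∈G → ⇝-injective P∈G P′∈G (⇝shiftMember _) (⇝shiftMember _))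

    shifted-uniform : ∀ {k} → All (λ P → ∣ P ∣ ≡ k) G → All (λ P → ∣ P ∣ ≡ k) shifted
    shifted-uniform = All.map⁺ ∘ All.map (λ {P} ∣P∣≡k → trans (⇝-∣∣ (⇝shiftMember P)) ∣P∣≡k)

    ∈-shifted⁺ : ∀ {P} → P ∈ G → a ∈ₛ P → P ∈ shifted
    ∈-shifted⁺ {P} P∈G a∈P = subst (_∈ shifted) (⇝-a∈ (⇝shiftMember P) a∈P) (∈-map⁺ shiftMember P∈G)

    ∈-shifted-a∉ : ∀ {Q} → Q ∈ shifted → a ∉ₛ Q → Q ∈ G × (b ∈ₛ Q → Q [ b ↦ a ] ∈ G)
    ∈-shifted-a∉ Q∈ a∉Q with P , P∈G , P⇝Q ← ∈-shifted⁻ Q∈ with ⇝-a∉ P⇝Q a∉Q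
    ... | refl , stable = P∈G , stable a∉Q

    shifted-stable : Stable a b shifted
    shifted-stable Q∈ a∉Q b∈Q = ∈-shifted⁺ (proj₂ (∈-shifted-a∉ Q∈ a∉Q) b∈Q) (a∈p[b↦a] _)

    shifted-preserves-stable : ∀ {c} → Stable a c G → Stable a c shifted
    shifted-preserves-stable stable Q∈ a∉Q c∈Q = ∈-shifted⁺ (stable (proj₁ (∈-shifted-a∉ Q∈ a∉Q)) a∉Q c∈Q) (a∈p[b↦a] _)

    module _ {r : ℕ} {A B : Fin r → Subset n} (A⇝B : ∀ i → A i ⇝ B i) where

      ⋂⇝-∈⁺ : ∀ {y} → y ≢ b → y ∈ₛ ⋂ (tabulate A) → y ∈ₛ ⋂ (tabulate B)
      ⋂⇝-∈⁺ y≢b y∈⋂A = ∈⋂⁺ (λ i → ⇝-∈⁺ (A⇝B i) y≢b (∈⋂⁻ A y∈⋂A i))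

      ⋂⇝-⊆ : (b ∈ₛ ⋂ (tabulate A) → b ∈ₛ ⋂ (tabulate B)) → ⋂ (tabulate A) ⊆ ⋂ (tabulate B)
      ⋂⇝-⊆ b∈⋂B {y} y∈⋂A with y ≟ b
      ... | yes refl = b∈⋂B y∈⋂A
      ... | no  y≢b  = ⋂⇝-∈⁺ y≢b y∈⋂A

      ⋂⇝-[↦]-⊆ : a ≢ b → a ∈ₛ ⋂ (tabulate B) → ⋂ (tabulate A) [ b ↦ a ] ⊆ ⋂ (tabulate B)
      ⋂⇝-[↦]-⊆ a≢b a∈⋂B {y} y∈ with y ≟ a
      ... | yes refl = a∈⋂B
      ... | no  y≢a  = ⋂⇝-∈⁺ (λ { refl → b∉p[b↦a] a≢b y∈ }) (∈-[↦]⁻ y≢a y∈)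

      module _ {t : ℕ} (intersecting : RWiseTIntersecting r t G) (A∈G : ∀ i → A i ∈ G) where

        ⋂⇝-bound-unmoved : (b ∈ₛ ⋂ (tabulate A) → b ∈ₛ ⋂ (tabulate B)) → t ≤ ∣ ⋂ (tabulate B) ∣
        ⋂⇝-bound-unmoved b∈⋂B = ≤-trans (intersecting A A∈G) (p⊆q⇒∣p∣≤∣q∣ (⋂⇝-⊆ b∈⋂B))

        ⋂⇝-bound-moved : a ∉ₛ ⋂ (tabulate A) → b ∈ₛ ⋂ (tabulate A) → a ∈ₛ ⋂ (tabulate B) → t ≤ ∣ ⋂ (tabulate B) ∣
        ⋂⇝-bound-moved a∉⋂A b∈⋂A a∈⋂B = ≤-trans (intersecting A A∈G) (≤-trans
          (≤-reflexive (sym (∣p[b↦a]∣ a∉⋂A b∈⋂A)))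
          (p⊆q⇒∣p∣≤∣q∣ (⋂⇝-[↦]-⊆ (∉∈⇒≢ a∉⋂A b∈⋂A) a∈⋂B)))

        -- A j = B j avoids a without having moved, so A j [ b ↦ a ] ∈ G; in its place it gives a
        -- tuple of G whose intersection misses a and b, hence lies in ⋂ B.
        ⋂⇝-bound-replaced : ∀ {c j} → a ∉ₛ A c → a ∈ₛ B c → a ∉ₛ B j → b ∈ₛ ⋂ (tabulate A) → t ≤ ∣ ⋂ (tabulate B) ∣
        ⋂⇝-bound-replaced {c} {j} a∉Ac a∈Bc a∉Bj b∈⋂A with Bj≡Aj , stable ← ⇝-a∉ (A⇝B j) a∉Bj =
          ≤-trans (intersecting D D∈G) (p⊆q⇒∣p∣≤∣q∣ ⋂D⊆⋂B)
          where
          D = updateAt A j (_[ b ↦ a ])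
          D∈G : ∀ i → D i ∈ G
          D∈G i with i ≟ j
          ... | yes refl = subst (_∈ G) (sym (updateAt-updates j A)) (stable (subst (a ∉ₛ_) Bj≡Aj a∉Bj) (∈⋂⁻ A b∈⋂A j))
          ... | no  i≢j  = subst (_∈ G) (sym (updateAt-minimal i j A i≢j)) (A∈G i)
          a∉⋂D : a ∉ₛ ⋂ (tabulate D)
          a∉⋂D a∈⋂D = a∉Ac (subst (a ∈ₛ_) (updateAt-minimal c j A c≢j) (∈⋂⁻ D a∈⋂D c))
            where
            c≢j : c ≢ j
            c≢j refl = a∉Bj a∈Bc
          ⋂D⊆⋂B : ⋂ (tabulate D) ⊆ ⋂ (tabulate B)
          ⋂D⊆⋂B y∈⋂D = ⋂⇝-∈⁺ (λ { refl → y∉⋂-updateAt-↦ A j (∉∈⇒≢ a∉Ac (∈⋂⁻ A b∈⋂A c)) y∈⋂D }) (⋂-updateAt-↦ A j a∉⋂D y∈⋂D)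

        ⋂⇝-bound : t ≤ ∣ ⋂ (tabulate B) ∣
        ⋂⇝-bound with b ∈ₛ? ⋂ (tabulate A) | b ∈ₛ? ⋂ (tabulate B)
        ... | no b∉⋂A  | _        = ⋂⇝-bound-unmoved (λ b∈⋂A → contradiction b∈⋂A b∉⋂A)
        ... | _        | yes b∈⋂B = ⋂⇝-bound-unmoved (λ _ → b∈⋂B)
        ... | yes b∈⋂A | no b∉⋂B
          with c , b∉Bc ← ¬∀⟶∃¬ r (λ i → b ∈ₛ B i) (λ i → b ∈ₛ? B i) (b∉⋂B ∘ ∈⋂⁺)
          with a∉Ac , a∈Bc ← ⇝-b∉ (A⇝B c) (∈⋂⁻ A b∈⋂A c) b∉Bc
          with a ∈ₛ? ⋂ (tabulate B)
        ... | yes a∈⋂B = ⋂⇝-bound-moved (λ a∈⋂A → a∉Ac (∈⋂⁻ A a∈⋂A c)) b∈⋂A a∈⋂B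
        ... | no  a∉⋂B
          with j , a∉Bj ← ¬∀⟶∃¬ r (λ i → a ∈ₛ B i) (λ i → a ∈ₛ? B i) (a∉⋂B ∘ ∈⋂⁺)
          = ⋂⇝-bound-replaced a∉Ac a∈Bc a∉Bj b∈⋂A

    shifted-intersecting : ∀ {r t} → RWiseTIntersecting r t G → RWiseTIntersecting r t shifted
    shifted-intersecting intersecting B B∈ =
      ⋂⇝-bound (λ i → proj₂ (proj₂ (∈-shifted⁻ (B∈ i)))) intersecting (λ i → proj₁ (proj₂ (∈-shifted⁻ (B∈ i))))

  ∣p∣>0⇒nonempty : ∀ {p : Subset n} → 0 < ∣ p ∣ → Nonempty p
  ∣p∣>0⇒nonempty {n} {p} 0<∣p∣ with nonempty? p
  ... | yes nonempty = nonempty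
  ... | no  empty    = contradiction 0<∣p∣ (<-irrefl (sym (trans (cong ∣_∣ (Empty-unique empty)) (∣⊥∣≡0 n))))

  module _ {a : Fin n} {G : List (Subset n)} {ρ t : ℕ}
           (stable : ∀ b → Stable a b G) (intersecting : RWiseTIntersecting (suc ρ) (suc t) G) where

    -- Trading a common point y for a in the member suc k keeps the tuple in G and removes y from
    -- the intersection, which still misses a because the member zero does.
    ⋂-bound-avoiding-prefix : ∀ c → c ≤ ρ → (D : Fin (suc ρ) → Subset n) → (∀ i → D i ∈ G) →
                              a ∉ₛ D zero → (∀ i → toℕ i < c → a ∉ₛ D (suc i)) → suc t + c ≤ ∣ ⋂ (tabulate D) ∣
    ⋂-bound-avoiding-prefix zero    _   D D∈G _ _ = subst (_≤ ∣ ⋂ (tabulate D) ∣) (sym (+-identityʳ (suc t))) (intersecting D D∈G)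
    ⋂-bound-avoiding-prefix (suc c) c<ρ D D∈G a∉D₀ a∉prefix
      with y , y∈⋂D ← ∣p∣>0⇒nonempty (≤-trans (s≤s z≤n) (intersecting D D∈G)) = begin
        suc t + suc c            ≡⟨ +-suc (suc t) c ⟩
        suc (suc t + c)          ≤⟨ s≤s IH ⟩
        suc ∣ ⋂ (tabulate D′) ∣  ≤⟨ p⊂q⇒∣p∣<∣q∣ ⋂D′⊂⋂D ⟩
        ∣ ⋂ (tabulate D) ∣       ∎
      where
      open ≤-Reasoning
      k = fromℕ< c<ρ
      a∉Dₖ : a ∉ₛ D (suc k)
      a∉Dₖ = a∉prefix k (s≤s (≤-reflexive (toℕ-fromℕ< c<ρ)))
      y∈Dₖ : y ∈ₛ D (suc k)
      y∈Dₖ = ∈⋂⁻ D y∈⋂D (suc k)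
      D′ = updateAt D (suc k) (_[ y ↦ a ])
      D′∈G : ∀ i → D′ i ∈ G
      D′∈G i with i ≟ suc k
      ... | yes refl = subst (_∈ G) (sym (updateAt-updates (suc k) D)) (stable y (D∈G (suc k)) a∉Dₖ y∈Dₖ)
      ... | no  i≢k  = subst (_∈ G) (sym (updateAt-minimal i (suc k) D i≢k)) (D∈G i)
      a∉D′-prefix : ∀ i → toℕ i < c → a ∉ₛ D′ (suc i)
      a∉D′-prefix i i<c = subst (a ∉ₛ_) (sym (updateAt-minimal (suc i) (suc k) D i≢k)) (a∉prefix i (m≤n⇒m≤1+n i<c))
        where
        i≢k : suc i ≢ suc k
        i≢k refl = <-irrefl (toℕ-fromℕ< c<ρ) i<c
      IH : suc t + c ≤ ∣ ⋂ (tabulate D′) ∣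
      IH = ⋂-bound-avoiding-prefix c (<⇒≤ c<ρ) D′ D′∈G a∉D₀ a∉D′-prefix
      ⋂D′⊂⋂D : ⋂ (tabulate D′) ⊂ ⋂ (tabulate D)
      ⋂D′⊂⋂D = ⋂-updateAt-↦ D (suc k) (λ a∈⋂D′ → a∉D₀ (∈⋂⁻ D′ a∈⋂D′ zero))
             , y , y∈⋂D , y∉⋂-updateAt-↦ D (suc k) (∉∈⇒≢ a∉Dₖ y∈Dₖ)

    ⋂-bound-avoiding : (D : Fin (suc ρ) → Subset n) → (∀ i → D i ∈ G) → (∀ i → a ∉ₛ D i) → suc t + ρ ≤ ∣ ⋂ (tabulate D) ∣
    ⋂-bound-avoiding D D∈G a∉D = ⋂-bound-avoiding-prefix ρ ≤-refl D D∈G (a∉D zero) (λ i _ → a∉D (suc i))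

module FamilyBound where

  open import Data.Nat using (ℕ; zero; suc; _+_; _≤_; z≤n)
  open import Data.Nat.Properties using (≤-refl; +-mono-≤; +-suc; ≤-pred; n≮n; module ≤-Reasoning)
  open import Data.Nat.Combinatorics using (_C_; nCk+nC[k+1]≡[n+1]C[k+1])
  open import Data.Fin using (Fin; zero; suc)
  open import Data.Fin.Subset using (Subset; inside; outside; ⋂; ∣_∣; _∩_)
  open import Data.Fin.Subset.Properties using (p⊆q⇒∣p∣≤∣q∣)
  open import Data.Vec using ([]; _∷_)
  open import Data.List using (List; []; _∷_; length; tabulate; foldr; allFin)
  open import Data.List.Membership.Propositional using (_∈_)
  open import Data.List.Membership.Propositional.Properties using (∈-allFin)
  open import Data.List.Relation.Unary.Any using (here; there)
  open import Data.List.Relation.Unary.All as All using (All; []; _∷_)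
  open import Data.List.Relation.Unary.AllPairs using ([]; _∷_)
  open import Data.List.Relation.Unary.Unique.Propositional using (Unique)
  open import Function using (_∘_)
  open import Relation.Binary.PropositionalEquality
  open import Relation.Nullary using (contradiction)
  open import Defs
  open SetSystems

  private variable
    n k r t : ℕ

  inside₀ : List (Subset (suc n)) → List (Subset n)
  inside₀ []                  = []
  inside₀ ((inside  ∷ p) ∷ G) = p ∷ inside₀ G
  inside₀ ((outside ∷ p) ∷ G) = inside₀ G

  outside₀ : List (Subset (suc n)) → List (Subset n)
  outside₀ []                  = []
  outside₀ ((inside  ∷ p) ∷ G) = outside₀ G
  outside₀ ((outside ∷ p) ∷ G) = p ∷ outside₀ G

  length-inside₀+outside₀ : ∀ (G : List (Subset (suc n))) → length (inside₀ G) + length (outside₀ G) ≡ length G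
  length-inside₀+outside₀ []                  = refl
  length-inside₀+outside₀ ((inside  ∷ p) ∷ G) = cong suc (length-inside₀+outside₀ G)
  length-inside₀+outside₀ ((outside ∷ p) ∷ G) = trans (+-suc (length (inside₀ G)) _) (cong suc (length-inside₀+outside₀ G))

  ∈-inside₀⁻ : ∀ {p} (G : List (Subset (suc n))) → p ∈ inside₀ G → (inside ∷ p) ∈ G
  ∈-inside₀⁻ ((inside  ∷ _) ∷ G) (here refl) = here refl
  ∈-inside₀⁻ ((inside  ∷ _) ∷ G) (there p∈)  = there (∈-inside₀⁻ G p∈)
  ∈-inside₀⁻ ((outside ∷ _) ∷ G) p∈          = there (∈-inside₀⁻ G p∈)

  ∈-outside₀⁻ : ∀ {p} (G : List (Subset (suc n))) → p ∈ outside₀ G → (outside ∷ p) ∈ G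
  ∈-outside₀⁻ ((outside ∷ _) ∷ G) (here refl) = here refl
  ∈-outside₀⁻ ((outside ∷ _) ∷ G) (there p∈)  = there (∈-outside₀⁻ G p∈)
  ∈-outside₀⁻ ((inside  ∷ _) ∷ G) p∈          = there (∈-outside₀⁻ G p∈)

  inside₀-unique : ∀ (G : List (Subset (suc n))) → Unique G → Unique (inside₀ G)
  inside₀-unique []                  []           = []
  inside₀-unique ((inside  ∷ p) ∷ G) (p∉G ∷ uniq) =
    All.tabulate (λ q∈ p≡q → All.lookup p∉G (∈-inside₀⁻ G q∈) (cong (inside ∷_) p≡q)) ∷ inside₀-unique G uniq
  inside₀-unique ((outside ∷ p) ∷ G) (_   ∷ uniq) = inside₀-unique G uniq

  outside₀-unique : ∀ (G : List (Subset (suc n))) → Unique G → Unique (outside₀ G)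
  outside₀-unique []                  []           = []
  outside₀-unique ((outside ∷ p) ∷ G) (p∉G ∷ uniq) =
    All.tabulate (λ q∈ p≡q → All.lookup p∉G (∈-outside₀⁻ G q∈) (cong (outside ∷_) p≡q)) ∷ outside₀-unique G uniq
  outside₀-unique ((inside  ∷ p) ∷ G) (_   ∷ uniq) = outside₀-unique G uniq

  inside₀-uniform : ∀ (G : List (Subset (suc n))) → All (λ P → ∣ P ∣ ≡ suc k) G → All (λ p → ∣ p ∣ ≡ k) (inside₀ G)
  inside₀-uniform []                  []               = []
  inside₀-uniform ((inside  ∷ p) ∷ G) (refl ∷ uniform) = refl ∷ inside₀-uniform G uniform
  inside₀-uniform ((outside ∷ p) ∷ G) (_    ∷ uniform) = inside₀-uniform G uniform

  inside₀-empty : ∀ (G : List (Subset (suc n))) → All (λ P → ∣ P ∣ ≡ 0) G → inside₀ G ≡ []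
  inside₀-empty []                  []               = refl
  inside₀-empty ((inside  ∷ p) ∷ G) (() ∷ _)
  inside₀-empty ((outside ∷ p) ∷ G) (_  ∷ uniform) = inside₀-empty G uniform

  outside₀-uniform : ∀ (G : List (Subset (suc n))) → All (λ P → ∣ P ∣ ≡ k) G → All (λ p → ∣ p ∣ ≡ k) (outside₀ G)
  outside₀-uniform []                  []               = []
  outside₀-uniform ((inside  ∷ p) ∷ G) (_    ∷ uniform) = outside₀-uniform G uniform
  outside₀-uniform ((outside ∷ p) ∷ G) (refl ∷ uniform) = refl ∷ outside₀-uniform G uniform

  ⋂-inside∷ : ∀ (B : Fin r → Subset n) → ⋂ (tabulate (λ i → inside ∷ B i)) ≡ inside ∷ ⋂ (tabulate B)
  ⋂-inside∷ {r = zero}  B = refl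
  ⋂-inside∷ {r = suc r} B = cong ((inside ∷ B zero) ∩_) (⋂-inside∷ (B ∘ suc))

  ⋂-outside∷ : ∀ (B : Fin (suc r) → Subset n) → ⋂ (tabulate (λ i → outside ∷ B i)) ≡ outside ∷ ⋂ (tabulate B)
  ⋂-outside∷ {r = zero}  B = refl
  ⋂-outside∷ {r = suc r} B = cong ((outside ∷ B zero) ∩_) (⋂-outside∷ (B ∘ suc))

  inside₀-intersecting : ∀ (G : List (Subset (suc n))) → RWiseTIntersecting r (suc t) G → RWiseTIntersecting r t (inside₀ G)
  inside₀-intersecting {t = t} G intersecting B B∈ = ≤-pred (subst (λ p → suc t ≤ ∣ p ∣) (⋂-inside∷ B)
    (intersecting (λ i → inside ∷ B i) (∈-inside₀⁻ G ∘ B∈)))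

  outside₀-intersecting : ∀ {ρ} (G : List (Subset (suc n))) → (∀ b → Stable zero b G) →
                          RWiseTIntersecting (suc ρ) (suc t) G → RWiseTIntersecting (suc ρ) (t + suc ρ) (outside₀ G)
  outside₀-intersecting {t = t} {ρ} G stable intersecting B B∈ = subst₂ (λ s p → s ≤ ∣ p ∣) (sym (+-suc t ρ)) (⋂-outside∷ B)
    (⋂-bound-avoiding stable intersecting (λ i → outside ∷ B i) (∈-outside₀⁻ G ∘ B∈) (λ _ ()))

  shiftedTowards : Fin n → List (Subset n) → List (Subset n)
  shiftedTowards a G = foldr (λ b → Shifting.shifted a b) G (allFin _)

  module _ (a : Fin n) where

    shiftedTowards-preserves : (P : List (Subset n) → Set) → (∀ b {H} → P H → P (Shifting.shifted a b H)) →
                               ∀ {G} → P G → P (shiftedTowards a G)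
    shiftedTowards-preserves P preserves {G} PG = go (allFin _)
      where
      go : ∀ bs → P (foldr (λ b → Shifting.shifted a b) G bs)
      go []       = PG
      go (b ∷ bs) = preserves b (go bs)

    shiftedTowards-stable : ∀ G b → Stable a b (shiftedTowards a G)
    shiftedTowards-stable G b = go (allFin _) (∈-allFin b)
      where
      go : ∀ bs → b ∈ bs → Stable a b (foldr (λ b → Shifting.shifted a b) G bs)
      go (b ∷ bs) (here refl)  = Shifting.shifted-stable a b _
      go (c ∷ bs) (there b∈bs) = Shifting.shifted-preserves-stable a c _ (go bs b∈bs)

  walkBound : ℕ → ℕ → ℕ → ℕ → ℕ
  walkBound r m       k       zero    = m C k
  walkBound r zero    k       (suc t) = 0
  walkBound r (suc m) zero    (suc t) = 0
  walkBound r (suc m) (suc k) (suc t) = walkBound r m k t + walkBound r m (suc k) (t + r)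

  length≤C : ∀ m k (G : List (Subset m)) → Unique G → All (λ P → ∣ P ∣ ≡ k) G → length G ≤ m C k
  length≤C zero    _       []             _                _        = z≤n
  length≤C zero    zero    ([] ∷ [])      _                _        = ≤-refl
  length≤C zero    (suc k) ([] ∷ _)       _                (() ∷ _)
  length≤C zero    zero    ([] ∷ [] ∷ _)  (([]≢[] ∷ _) ∷ _) _     = contradiction refl []≢[]
  length≤C (suc m) zero    G              uniq             uniform  =
    subst (_≤ m C 0) (trans (cong (λ l → length l + length (outside₀ G)) (sym (inside₀-empty G uniform))) (length-inside₀+outside₀ G))
      (length≤C m 0 (outside₀ G) (outside₀-unique G uniq) (outside₀-uniform G uniform))
  length≤C (suc m) (suc k) G              uniq             uniform  = begin
    length G                                   ≡⟨ length-inside₀+outside₀ G ⟨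
    length (inside₀ G) + length (outside₀ G)   ≤⟨ +-mono-≤ (length≤C m k (inside₀ G) (inside₀-unique G uniq) (inside₀-uniform G uniform))
                                                            (length≤C m (suc k) (outside₀ G) (outside₀-unique G uniq) (outside₀-uniform G uniform)) ⟩
    m C k + m C suc k                          ≡⟨ nCk+nC[k+1]≡[n+1]C[k+1] m k ⟩
    suc m C suc k                              ∎
    where open ≤-Reasoning

  intersecting-empty : ∀ {ρ} {G : List (Subset n)} → k ≤ t → All (λ P → ∣ P ∣ ≡ k) G →
                       RWiseTIntersecting (suc ρ) (suc t) G → length G ≤ 0
  intersecting-empty         {G = []}    _   _              _            = z≤n
  intersecting-empty {k = k} {t = t} {ρ} {P ∷ G} k≤t (∣P∣≡k ∷ _) intersecting = contradiction (begin
    suc t                                ≤⟨ intersecting (λ _ → P) (λ _ → here refl) ⟩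
    ∣ ⋂ (tabulate P′) ∣                  ≤⟨ p⊆q⇒∣p∣≤∣q∣ (λ x∈ → ∈⋂⁻ P′ x∈ zero) ⟩
    ∣ P ∣                                ≡⟨ ∣P∣≡k ⟩
    k                                    ≤⟨ k≤t ⟩
    t                                    ∎) (n≮n t)
    where
    open ≤-Reasoning
    P′ : Fin (suc ρ) → Subset _
    P′ _ = P

  length≤walkBound : ∀ {ρ} m k t (G : List (Subset m)) → Unique G → All (λ P → ∣ P ∣ ≡ k) G →
                     RWiseTIntersecting (suc ρ) t G → length G ≤ walkBound (suc ρ) m k t
  length≤walkBound m       k       zero    G        uniq uniform _            = length≤C m k G uniq uniform
  length≤walkBound zero    k       (suc t) []       _    _       _            = z≤n
  length≤walkBound zero    k       (suc t) ([] ∷ G) _    uniform@(refl ∷ _) intersecting = intersecting-empty z≤n uniform intersecting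
  length≤walkBound (suc m) zero    (suc t) G        _    uniform intersecting = intersecting-empty z≤n uniform intersecting
  length≤walkBound {ρ} (suc m) (suc k) (suc t) G    uniq uniform intersecting = begin
    length G                                  ≡⟨ length-H ⟨
    length H                                  ≡⟨ length-inside₀+outside₀ H ⟨
    length (inside₀ H) + length (outside₀ H)  ≤⟨ +-mono-≤
      (length≤walkBound m k t (inside₀ H) (inside₀-unique H unique-H) (inside₀-uniform H uniform-H)
        (inside₀-intersecting H intersecting-H))
      (length≤walkBound m (suc k) (t + suc ρ) (outside₀ H) (outside₀-unique H unique-H) (outside₀-uniform H uniform-H)
        (outside₀-intersecting H (shiftedTowards-stable zero G) intersecting-H)) ⟩
    walkBound (suc ρ) (suc m) (suc k) (suc t) ∎
    where
    open ≤-Reasoning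
    H = shiftedTowards zero G
    length-H : length H ≡ length G
    length-H = shiftedTowards-preserves zero (λ H → length H ≡ length G) (λ b {H} eq → trans (Shifting.length-shifted zero b H) eq) {G} refl
    unique-H : Unique H
    unique-H = shiftedTowards-preserves zero Unique (λ b {H} → Shifting.shifted-unique zero b H) uniq
    uniform-H : All (λ P → ∣ P ∣ ≡ suc k) H
    uniform-H = shiftedTowards-preserves zero (All (λ P → ∣ P ∣ ≡ suc k)) (λ b {H} → Shifting.shifted-uniform zero b H) uniform
    intersecting-H : RWiseTIntersecting (suc ρ) (suc t) H
    intersecting-H = shiftedTowards-preserves zero (RWiseTIntersecting (suc ρ) (suc t)) (λ b {H} → Shifting.shifted-intersecting zero b H) intersecting

module Arithmetic where

  open import Data.Nat
  open import Data.Nat.Properties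
  open import Data.Nat.Combinatorics using (_C_; nCk+nC[k+1]≡[n+1]C[k+1]; nC1≡n; nCk≡nC[n∸k])
  open import Data.Nat.Tactic.RingSolver using (solve-∀)
  open import Data.Product using (_,_)
  open import Relation.Binary.PropositionalEquality
  open import Algebra.Properties.CommutativeSemigroup *-commutativeSemigroup using (x∙yz≈y∙xz)

  C-absorb : ∀ n k → suc k * (suc n C suc k) ≡ suc n * (n C k)
  C-absorb zero    zero    = refl
  C-absorb zero    (suc k) = *-zeroʳ (2 + k)
  C-absorb (suc n) zero    = begin
    1 * ((2 + n) C 1)  ≡⟨ *-identityˡ ((2 + n) C 1) ⟩
    (2 + n) C 1        ≡⟨ nC1≡n (2 + n) ⟩
    2 + n              ≡⟨ *-identityʳ (2 + n) ⟨
    (2 + n) * 1        ∎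
    where open ≡-Reasoning
  C-absorb (suc n) (suc k) = begin
    (2 + k) * ((2 + n) C (2 + k))                    ≡⟨ cong ((2 + k) *_) (nCk+nC[k+1]≡[n+1]C[k+1] (suc n) (suc k)) ⟨
    (2 + k) * (x + y)                                ≡⟨ split-factor k x y ⟩
    x + ((1 + k) * x + (2 + k) * y)                  ≡⟨ cong (x +_) (cong₂ _+_ (C-absorb n k) (C-absorb n (suc k))) ⟩
    x + ((1 + n) * (n C k) + (1 + n) * (n C suc k))  ≡⟨ cong (x +_) (*-distribˡ-+ (1 + n) (n C k) (n C suc k)) ⟨
    x + (1 + n) * (n C k + n C suc k)                ≡⟨ cong (λ z → x + (1 + n) * z) (nCk+nC[k+1]≡[n+1]C[k+1] n k) ⟩
    (2 + n) * x                                      ∎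
    where
    open ≡-Reasoning
    x = suc n C suc k
    y = suc n C (2 + k)
    split-factor : ∀ k x y → (2 + k) * (x + y) ≡ x + ((1 + k) * x + (2 + k) * y)
    split-factor = solve-∀

  C-sym : ∀ a b → (a + b) C a ≡ (a + b) C b
  C-sym a b = trans (nCk≡nC[n∸k] (m≤m+n a b)) (cong ((a + b) C_) (m+n∸m≡n a b))

  C-extend : ∀ {n k e} → k + e ≡ n → suc e * (suc n C k) ≡ suc n * (n C k)
  C-extend {k = k} {e} refl = begin
    suc e * (suc (k + e) C k)         ≡⟨ cong (λ m → suc e * (m C k)) (+-suc k e) ⟨
    suc e * ((k + suc e) C k)         ≡⟨ cong (suc e *_) (C-sym k (suc e)) ⟩
    suc e * ((k + suc e) C suc e)     ≡⟨ cong (λ m → suc e * (m C suc e)) (+-suc k e) ⟩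
    suc e * (suc (k + e) C suc e)     ≡⟨ C-absorb (k + e) e ⟩
    suc (k + e) * ((k + e) C e)       ≡⟨ cong (suc (k + e) *_) (C-sym k e) ⟨
    suc (k + e) * ((k + e) C k)       ∎
    where open ≡-Reasoning

  C-double-step : ∀ {n k} → 2 * k < n → 2 * (n C k) ≤ suc n C suc k
  C-double-step {n} {k} 2k<n = *-cancelˡ-≤ (suc k) (begin
    suc k * (2 * (n C k))        ≡⟨ *-assoc (suc k) 2 (n C k) ⟨
    (suc k * 2) * (n C k)        ≡⟨ cong (_* (n C k)) (double-suc k) ⟩
    suc (suc (2 * k)) * (n C k)  ≤⟨ *-monoˡ-≤ (n C k) (s≤s 2k<n) ⟩
    suc n * (n C k)              ≡⟨ C-absorb n k ⟨
    suc k * (suc n C suc k)      ∎)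
    where
    open ≤-Reasoning
    double-suc : ∀ k → suc k * 2 ≡ suc (suc (2 * k))
    double-suc = solve-∀

  C-octuple-step : ∀ {n k} → 2 * k + 2 ≤ n → 8 * (n C k) ≤ (3 + n) C (2 + k)
  C-octuple-step {n} {k} h with d , refl ← m≤n⇒∃[o]m+o≡n h = *-cancelˡ-≤ X (begin
    X * (8 * (n C k))        ≡⟨ x∙yz≈y∙xz X 8 (n C k) ⟩
    8 * (X * (n C k))        ≡⟨ *-assoc 8 X (n C k) ⟨
    (8 * X) * (n C k)        ≤⟨ *-monoˡ-≤ (n C k) 8X≤Y ⟩
    Y * (n C k)              ≡⟨ XC≡YC ⟨
    X * ((3 + n) C (2 + k))  ∎)
    where
    open ≤-Reasoning
    e = k + 2 + d
    X = (1 + e) * ((1 + k) * (2 + k))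
    Y = (3 + n) * ((2 + n) * (1 + n))
    C₀ = n C k
    C₁ = (1 + n) C k
    C₂ = (2 + n) C (1 + k)
    C₃ = (3 + n) C (2 + k)
    XC≡YC : X * C₃ ≡ Y * C₀
    XC≡YC = begin-equality
      X * C₃                                    ≡⟨ *-assoc (1 + e) ((1 + k) * (2 + k)) C₃ ⟩
      (1 + e) * (((1 + k) * (2 + k)) * C₃)      ≡⟨ cong ((1 + e) *_) (*-assoc (1 + k) (2 + k) C₃) ⟩
      (1 + e) * ((1 + k) * ((2 + k) * C₃))      ≡⟨ cong (λ z → (1 + e) * ((1 + k) * z)) (C-absorb (2 + n) (1 + k)) ⟩
      (1 + e) * ((1 + k) * ((3 + n) * C₂))      ≡⟨ cong ((1 + e) *_) (x∙yz≈y∙xz (1 + k) (3 + n) C₂) ⟩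
      (1 + e) * ((3 + n) * ((1 + k) * C₂))      ≡⟨ x∙yz≈y∙xz (1 + e) (3 + n) ((1 + k) * C₂) ⟩
      (3 + n) * ((1 + e) * ((1 + k) * C₂))      ≡⟨ cong (λ z → (3 + n) * ((1 + e) * z)) (C-absorb (1 + n) k) ⟩
      (3 + n) * ((1 + e) * ((2 + n) * C₁))      ≡⟨ cong ((3 + n) *_) (x∙yz≈y∙xz (1 + e) (2 + n) C₁) ⟩
      (3 + n) * ((2 + n) * ((1 + e) * C₁))      ≡⟨ cong (λ z → (3 + n) * ((2 + n) * z)) (C-extend {n} {k} {e} (k+e≡n k d)) ⟩
      (3 + n) * ((2 + n) * ((1 + n) * C₀))      ≡⟨ cong ((3 + n) *_) (*-assoc (2 + n) (1 + n) C₀) ⟨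
      (3 + n) * (((2 + n) * (1 + n)) * C₀)      ≡⟨ *-assoc (3 + n) ((2 + n) * (1 + n)) C₀ ⟨
      Y * C₀                                    ∎
      where
      k+e≡n : ∀ k d → k + (k + 2 + d) ≡ 2 * k + 2 + d
      k+e≡n = solve-∀
    8X≤Y : 8 * X ≤ Y
    8X≤Y = begin
      8 * X                                                              ≡⟨ regroup k d ⟩
      (4 * ((1 + k) * (1 + e))) * (2 * (2 + k))                          ≤⟨ *-mono-≤ (m≤m+n (4 * ((1 + k) * (1 + e))) ((1 + d) * (3 + d)))
                                                                                      (m≤m+n (2 * (2 + k)) d) ⟩
      (4 * ((1 + k) * (1 + e)) + (1 + d) * (3 + d)) * (2 * (2 + k) + d)  ≡⟨ am-gm k d ⟩
      Y                                                                  ∎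
      where
      regroup : ∀ k d → 8 * ((1 + (k + 2 + d)) * ((1 + k) * (2 + k))) ≡ (4 * ((1 + k) * (1 + (k + 2 + d)))) * (2 * (2 + k))
      regroup = solve-∀
      -- With u = 1 + k and v = 1 + e: (u + v − 1)(u + v + 1) − 4uv = (v − u)² − 1, where v − u = 2 + d.
      am-gm : ∀ k d → (4 * ((1 + k) * (1 + (k + 2 + d))) + (1 + d) * (3 + d)) * (2 * (2 + k) + d)
                      ≡ (3 + (2 * k + 2 + d)) * ((2 + (2 * k + 2 + d)) * (1 + (2 * k + 2 + d)))
      am-gm = solve-∀

  C-doubling : ∀ e {n k} → 2 * k + e ≤ n → 2 ^ e * (n C k) ≤ (e + n) C (e + k)
  C-doubling zero    {n} {k} _ = ≤-reflexive (+-identityʳ (n C k))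
  C-doubling (suc e) {n} {k} h = begin
    2 * 2 ^ e * (n C k)            ≡⟨ *-assoc 2 (2 ^ e) (n C k) ⟩
    2 * (2 ^ e * (n C k))          ≤⟨ *-monoʳ-≤ 2 (C-doubling e (≤-trans (+-monoʳ-≤ (2 * k) (n≤1+n e)) h)) ⟩
    2 * ((e + n) C (e + k))        ≤⟨ C-double-step {e + n} {e + k} (≤-trans (≤-reflexive (shuffle e k)) (+-monoʳ-≤ e h)) ⟩
    suc (e + n) C suc (e + k)      ∎
    where
    open ≤-Reasoning
    shuffle : ∀ e k → suc (2 * (e + k)) ≡ e + (2 * k + suc e)
    shuffle = solve-∀

  C-octupling : ∀ i {n k} → 2 * k + i < n → 8 ^ i * (n C k) ≤ (3 * i + n) C (2 * i + k)
  C-octupling zero    {n} {k} _ = ≤-reflexive (+-identityʳ (n C k))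
  C-octupling (suc i) {n} {k} h = begin
    8 * 8 ^ i * (n C k)                      ≡⟨ *-assoc 8 (8 ^ i) (n C k) ⟩
    8 * (8 ^ i * (n C k))                    ≤⟨ *-monoʳ-≤ 8 (C-octupling i (≤-trans (s≤s (+-monoʳ-≤ (2 * k) (n≤1+n i))) h)) ⟩
    8 * ((3 * i + n) C (2 * i + k))          ≤⟨ C-octuple-step {3 * i + n} {2 * i + k} (≤-trans (≤-reflexive (shuffle i k)) (+-monoʳ-≤ (3 * i) h)) ⟩
    (3 + (3 * i + n)) C (2 + (2 * i + k))    ≡⟨ cong₂ _C_ (step 3 i n) (step 2 i k) ⟩
    (3 * suc i + n) C (2 * suc i + k)        ∎
    where
    open ≤-Reasoning
    shuffle : ∀ i k → 2 * (2 * i + k) + 2 ≡ 3 * i + suc (2 * k + suc i)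
    shuffle = solve-∀
    step : ∀ a i n → a + (a * i + n) ≡ a * suc i + n
    step = solve-∀

  -- With j = 2i + 1 + d: i steps (n, k) ↦ (3 + n, 2 + k), then 1 + d steps (n, k) ↦ (1 + n, 1 + k).
  2^[i+j]*mCk≤[i+j+m]C[j+k] : ∀ i j m k → 2 * (j + k) ≤ i + j + m → 2 * i < j →
                              2 ^ (i + j) * (m C k) ≤ (i + j + m) C (j + k)
  2^[i+j]*mCk≤[i+j+m]C[j+k] i j m k h 2i<j with d , refl ← m≤n⇒∃[o]m+o≡n 2i<j = begin
    2 ^ (i + j) * (m C k)                          ≡⟨ cong (_* (m C k)) (split-power i d) ⟩
    2 ^ suc d * 8 ^ i * (m C k)                    ≡⟨ *-assoc (2 ^ suc d) (8 ^ i) (m C k) ⟩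
    2 ^ suc d * (8 ^ i * (m C k))                  ≤⟨ *-monoʳ-≤ (2 ^ suc d) (C-octupling i 2k+i<m) ⟩
    2 ^ suc d * ((3 * i + m) C (2 * i + k))        ≤⟨ C-doubling (suc d) room ⟩
    (suc d + (3 * i + m)) C (suc d + (2 * i + k))  ≡⟨ cong₂ _C_ (top i d m) (bottom i d k) ⟩
    (i + j + m) C (j + k)                          ∎
    where
    open ≤-Reasoning
    slack : 2 * k + i + suc d ≤ m
    slack = +-cancelˡ-≤ (suc (3 * i) + d) _ _ (≤-trans (≤-reflexive (lhs i d k)) (≤-trans h (≤-reflexive (rhs i d m))))
      where
      lhs : ∀ i d k → suc (3 * i) + d + (2 * k + i + suc d) ≡ 2 * (suc (2 * i) + d + k)
      lhs = solve-∀
      rhs : ∀ i d m → i + (suc (2 * i) + d) + m ≡ suc (3 * i) + d + m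
      rhs = solve-∀
    2k+i<m : 2 * k + i < m
    2k+i<m = ≤-trans (s≤s (m≤m+n (2 * k + i) d)) (≤-trans (≤-reflexive (sym (+-suc (2 * k + i) d))) slack)
    room : 2 * (2 * i + k) + suc d ≤ 3 * i + m
    room = ≤-trans (≤-reflexive (shuffle i d k)) (+-monoʳ-≤ (3 * i) slack)
      where
      shuffle : ∀ i d k → 2 * (2 * i + k) + suc d ≡ 3 * i + (2 * k + i + suc d)
      shuffle = solve-∀
    split-power : ∀ i d → 2 ^ (i + (suc (2 * i) + d)) ≡ 2 ^ suc d * 8 ^ i
    split-power i d = begin-equality
      2 ^ (i + (suc (2 * i) + d))  ≡⟨ cong (2 ^_) (exponent i d) ⟩
      2 ^ (suc d + 3 * i)          ≡⟨ ^-distribˡ-+-* 2 (suc d) (3 * i) ⟩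
      2 ^ suc d * 2 ^ (3 * i)      ≡⟨ cong (2 ^ suc d *_) (^-*-assoc 2 3 i) ⟨
      2 ^ suc d * 8 ^ i            ∎
      where
      exponent : ∀ i d → i + (suc (2 * i) + d) ≡ suc d + 3 * i
      exponent = solve-∀
    top : ∀ i d m → suc d + (3 * i + m) ≡ i + (suc (2 * i) + d) + m
    top = solve-∀
    bottom : ∀ i d k → suc d + (2 * i + k) ≡ suc (2 * i) + d + k
    bottom = solve-∀

  budget⇒2i<j : ∀ {r t} i j → 3 ≤ r → 1 ≤ t → i + j + 0 ≡ i * r + t → 2 * i < j
  budget⇒2i<j {r} {t} i j 3≤r 1≤t budget = +-cancelˡ-≤ i _ _ (begin
    i + suc (2 * i)    ≡⟨ shuffle i ⟩
    i * 3 + 1          ≤⟨ +-mono-≤ (*-monoʳ-≤ i 3≤r) 1≤t ⟩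
    i * r + t          ≡⟨ budget ⟨
    i + j + 0          ≡⟨ +-identityʳ (i + j) ⟩
    i + j              ∎)
    where
    open ≤-Reasoning
    shuffle : ∀ i → i + suc (2 * i) ≡ i * 3 + 1
    shuffle = solve-∀

  budget-avoid : ∀ {r t} i j T → i + j + suc T ≡ i * r + t → suc i + j + (T + r) ≡ suc i * r + t
  budget-avoid {r} {t} i j T budget = begin
    suc i + j + (T + r)   ≡⟨ shuffle i j T r ⟩
    i + j + suc T + r     ≡⟨ cong (_+ r) budget ⟩
    i * r + t + r         ≡⟨ regroup i r t ⟩
    suc i * r + t         ∎
    where
    open ≡-Reasoning
    shuffle : ∀ i j T r → suc i + j + (T + r) ≡ i + j + suc T + r
    shuffle = solve-∀
    regroup : ∀ i r t → i * r + t + r ≡ suc i * r + t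
    regroup = solve-∀

  +-suc-middle : ∀ a b c → a + suc b + c ≡ a + b + suc c
  +-suc-middle = solve-∀

  +-suc-left : ∀ a b c → suc a + b + c ≡ a + b + suc c
  +-suc-left = solve-∀

  double-weight : ∀ i j x y → 2 ^ (i + j) * (x + y) + 2 ^ (i + j) * (x + y) ≡ 2 ^ (i + suc j) * x + 2 ^ (suc i + j) * y
  double-weight i j x y = begin
    w * (x + y) + w * (x + y)              ≡⟨ distribute w x y ⟩
    2 * w * x + 2 * w * y                  ≡⟨ cong (λ e → 2 ^ e * x + 2 * w * y) (+-suc i j) ⟨
    2 ^ (i + suc j) * x + 2 ^ (suc i + j) * y  ∎
    where
    open ≡-Reasoning
    w = 2 ^ (i + j)
    distribute : ∀ w x y → w * (x + y) + w * (x + y) ≡ 2 * w * x + 2 * w * y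
    distribute = solve-∀

module Counting where

  open import Data.Nat as ℕ using (ℕ; zero; suc)
  import Data.Nat.Properties as ℕ
  open import Data.Nat.Combinatorics using (_C_)
  open import Data.Nat.Coprimality as Coprime using (1-coprimeTo)
  open import Data.Integer as ℤ using (+_; +≤+)
  import Data.Integer.Properties as ℤ
  open import Data.Rational using (ℚ; mkℚ; 0ℚ; 1ℚ; _+_; _*_; _≤_; _<_; *≤*; _/_; nonNegative)
  open import Data.Rational.Properties
  open import Relation.Binary.PropositionalEquality
  open import Defs
  open Arithmetic
  open FamilyBound using (walkBound)

  private
    mkℚ[a/1] : ℕ → ℚ
    mkℚ[a/1] a = mkℚ (+ a) 0 (Coprime.sym (1-coprimeTo a))

    ℕ→ℚ≡mkℚ[a/1] : ∀ a → ℕ→ℚ a ≡ mkℚ[a/1] a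
    ℕ→ℚ≡mkℚ[a/1] a = normalize-coprime (Coprime.sym (1-coprimeTo a))

  ℕ→ℚ-+ : ∀ a b → ℕ→ℚ (a ℕ.+ b) ≡ ℕ→ℚ a + ℕ→ℚ b
  ℕ→ℚ-+ a b = begin
    + (a ℕ.+ b) / 1                    ≡⟨ /-cong numerator refl ⟨
    (+ a ℤ.* + 1 ℤ.+ + b ℤ.* + 1) / 1  ≡⟨⟩
    mkℚ[a/1] a + mkℚ[a/1] b            ≡⟨ cong₂ _+_ (ℕ→ℚ≡mkℚ[a/1] a) (ℕ→ℚ≡mkℚ[a/1] b) ⟨
    ℕ→ℚ a + ℕ→ℚ b                      ∎
    where
    open ≡-Reasoning
    numerator : + a ℤ.* + 1 ℤ.+ + b ℤ.* + 1 ≡ + (a ℕ.+ b)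
    numerator = trans (cong₂ ℤ._+_ (ℤ.*-identityʳ (+ a)) (ℤ.*-identityʳ (+ b))) (sym (ℤ.pos-+ a b))

  ℕ→ℚ-mono : ∀ {a b} → a ℕ.≤ b → ℕ→ℚ a ≤ ℕ→ℚ b
  ℕ→ℚ-mono {a} {b} a≤b = subst₂ _≤_ (sym (ℕ→ℚ≡mkℚ[a/1] a)) (sym (ℕ→ℚ≡mkℚ[a/1] b)) (*≤* (ℤ.*-monoʳ-≤-nonNeg (+ 1) (+≤+ a≤b)))

  ^ℚ-+ : ∀ q a b → q ^ℚ (a ℕ.+ b) ≡ q ^ℚ a * q ^ℚ b
  ^ℚ-+ q zero    b = sym (*-identityˡ (q ^ℚ b))
  ^ℚ-+ q (suc a) b = trans (cong (q *_) (^ℚ-+ q a b)) (sym (*-assoc q (q ^ℚ a) (q ^ℚ b)))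

  ^ℚ-nonNeg : ∀ {q} → 0ℚ ≤ q → ∀ a → 0ℚ ≤ q ^ℚ a
  ^ℚ-nonNeg 0≤q zero    = *≤* (+≤+ ℕ.z≤n)
  ^ℚ-nonNeg {q} 0≤q (suc a) = nonNegative⁻¹ (q * q ^ℚ a)
    {{nonNeg*nonNeg⇒nonNeg q {{nonNegative 0≤q}} (q ^ℚ a) {{nonNegative (^ℚ-nonNeg 0≤q a)}}}}

  halve-≤ : ∀ {x y} → x + x ≤ y + y → x ≤ y
  halve-≤ x+x≤y+y = ≮⇒≥ (λ y<x → <-irrefl refl (<-≤-trans (+-mono-< y<x y<x) x+x≤y+y))

  module _ {q : ℚ} {r : ℕ} (root : 1ℚ + q ^ℚ r < q + q) where

    averaging-step : ∀ {w a b P} → 0ℚ ≤ P → a ≤ P → b ≤ q ^ℚ r * P → w + w ≤ a + b → w ≤ q * P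
    averaging-step {w} {a} {b} {P} 0≤P a≤P b≤qʳP w+w≤a+b = halve-≤ (begin
      w + w                  ≤⟨ w+w≤a+b ⟩
      a + b                  ≤⟨ +-mono-≤ a≤P b≤qʳP ⟩
      P + q ^ℚ r * P         ≡⟨ cong (_+ q ^ℚ r * P) (*-identityˡ P) ⟨
      1ℚ * P + q ^ℚ r * P    ≡⟨ *-distribʳ-+ P 1ℚ (q ^ℚ r) ⟨
      (1ℚ + q ^ℚ r) * P      ≤⟨ *-monoʳ-≤-nonNeg P {{nonNegative 0≤P}} (<⇒≤ root) ⟩
      (q + q) * P            ≡⟨ *-distribʳ-+ P q q ⟩
      q * P + q * P          ∎)
      where open ≤-Reasoning

  module _ {q : ℚ} {r t n k : ℕ} (0≤q : 0ℚ ≤ q) (root : 1ℚ + q ^ℚ r < q + q)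
           (3≤r : 3 ℕ.≤ r) (1≤t : 1 ℕ.≤ t) (2k≤n : 2 ℕ.* k ℕ.≤ n) where

    private
      target : ℕ → ℚ
      target T = q ^ℚ T * ℕ→ℚ (n C k)

      target-nonNeg : ∀ T → 0ℚ ≤ target T
      target-nonNeg T = nonNegative⁻¹ (target T)
        {{nonNeg*nonNeg⇒nonNeg (q ^ℚ T) {{nonNegative (^ℚ-nonNeg 0≤q T)}} (ℕ→ℚ (n C k)) {{nonNegative (ℕ→ℚ-mono {0} {n C k} ℕ.z≤n)}}}}

      dead-end : ∀ w T → ℕ→ℚ (w ℕ.* 0) ≤ target T
      dead-end w T = subst (λ x → ℕ→ℚ x ≤ target T) (sym (ℕ.*-zeroʳ w)) (target-nonNeg T)

    -- The state (m, l, T) is reached from (n, k, t) by i steps avoiding 0 and j steps through 0.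
    walkBound-weighted : ∀ i j m l T → i ℕ.+ j ℕ.+ m ≡ n → j ℕ.+ l ≡ k → i ℕ.+ j ℕ.+ T ≡ i ℕ.* r ℕ.+ t →
                         ℕ→ℚ (2 ℕ.^ (i ℕ.+ j) ℕ.* walkBound r m l T) ≤ q ^ℚ T * ℕ→ℚ (n C k)
    walkBound-weighted i j m l zero eₙ eₖ budget = ≤-trans (ℕ→ℚ-mono growth) (≤-reflexive (sym (*-identityˡ (ℕ→ℚ (n C k)))))
      where
      growth : 2 ℕ.^ (i ℕ.+ j) ℕ.* (m C l) ℕ.≤ n C k
      growth = subst₂ (λ a b → 2 ℕ.^ (i ℕ.+ j) ℕ.* (m C l) ℕ.≤ a C b) eₙ eₖ
        (2^[i+j]*mCk≤[i+j+m]C[j+k] i j m l (subst₂ (λ a b → 2 ℕ.* a ℕ.≤ b) (sym eₖ) (sym eₙ) 2k≤n) (budget⇒2i<j i j 3≤r 1≤t budget))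
    walkBound-weighted i j zero    l       (suc T) _ _ _ = dead-end (2 ℕ.^ (i ℕ.+ j)) (suc T)
    walkBound-weighted i j (suc m) zero    (suc T) _ _ _ = dead-end (2 ℕ.^ (i ℕ.+ j)) (suc T)
    walkBound-weighted i j (suc m) (suc l) (suc T) eₙ eₖ budget = begin
      ℕ→ℚ (w ℕ.* (X ℕ.+ Y))  ≤⟨ averaging-step {q} {r} root (target-nonNeg T) contain-bound avoid-bound doubled ⟩
      q * target T           ≡⟨ *-assoc q (q ^ℚ T) (ℕ→ℚ (n C k)) ⟨
      target (suc T)         ∎
      where
      open ≤-Reasoning
      w = 2 ℕ.^ (i ℕ.+ j)
      X = walkBound r m l T
      Y = walkBound r m (suc l) (T ℕ.+ r)
      contain-bound : ℕ→ℚ (2 ℕ.^ (i ℕ.+ suc j) ℕ.* X) ≤ target T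
      contain-bound = walkBound-weighted i (suc j) m l T
        (trans (+-suc-middle i j m) eₙ) (trans (sym (ℕ.+-suc j l)) eₖ) (trans (+-suc-middle i j T) budget)
      avoid-bound : ℕ→ℚ (2 ℕ.^ (suc i ℕ.+ j) ℕ.* Y) ≤ q ^ℚ r * target T
      avoid-bound = ≤-trans (walkBound-weighted (suc i) j m (suc l) (T ℕ.+ r) (trans (+-suc-left i j m) eₙ) eₖ (budget-avoid i j T budget))
        (≤-reflexive (begin-equality
          q ^ℚ (T ℕ.+ r) * ℕ→ℚ (n C k)   ≡⟨ cong (λ e → q ^ℚ e * ℕ→ℚ (n C k)) (ℕ.+-comm T r) ⟩
          q ^ℚ (r ℕ.+ T) * ℕ→ℚ (n C k)   ≡⟨ cong (_* ℕ→ℚ (n C k)) (^ℚ-+ q r T) ⟩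
          q ^ℚ r * q ^ℚ T * ℕ→ℚ (n C k)  ≡⟨ *-assoc (q ^ℚ r) (q ^ℚ T) (ℕ→ℚ (n C k)) ⟩
          q ^ℚ r * target T              ∎))
      doubled : ℕ→ℚ (w ℕ.* (X ℕ.+ Y)) + ℕ→ℚ (w ℕ.* (X ℕ.+ Y)) ≤ ℕ→ℚ (2 ℕ.^ (i ℕ.+ suc j) ℕ.* X) + ℕ→ℚ (2 ℕ.^ (suc i ℕ.+ j) ℕ.* Y)
      doubled = ≤-reflexive (begin-equality
        ℕ→ℚ (w ℕ.* (X ℕ.+ Y)) + ℕ→ℚ (w ℕ.* (X ℕ.+ Y))                   ≡⟨ ℕ→ℚ-+ (w ℕ.* (X ℕ.+ Y)) (w ℕ.* (X ℕ.+ Y)) ⟨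
        ℕ→ℚ (w ℕ.* (X ℕ.+ Y) ℕ.+ w ℕ.* (X ℕ.+ Y))                       ≡⟨ cong ℕ→ℚ (double-weight i j X Y) ⟩
        ℕ→ℚ (2 ℕ.^ (i ℕ.+ suc j) ℕ.* X ℕ.+ 2 ℕ.^ (suc i ℕ.+ j) ℕ.* Y)   ≡⟨ ℕ→ℚ-+ (2 ℕ.^ (i ℕ.+ suc j) ℕ.* X) (2 ℕ.^ (suc i ℕ.+ j) ℕ.* Y) ⟩
        ℕ→ℚ (2 ℕ.^ (i ℕ.+ suc j) ℕ.* X) + ℕ→ℚ (2 ℕ.^ (suc i ℕ.+ j) ℕ.* Y)  ∎)

open import Defs
open import Data.Nat using (ℕ; _≤_; _*_)
open import Data.Nat.Combinatorics using (_C_)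
open import Data.Rational as ℚ using (ℚ; 0ℚ; 1ℚ; _<_; _+_)
open import Data.Fin.Subset using (Subset)
open import Data.List using (List; length)
open import Data.Nat as ℕ using (s≤s)
import Data.Nat.Properties as ℕ
import Data.Rational.Properties as ℚ
open import Data.Product using (_,_)
open import Relation.Binary.PropositionalEquality using (refl; cong)
open FamilyBound using (walkBound; length≤walkBound)
open Counting using (ℕ→ℚ-mono; walkBound-weighted)

proposition4p4 : (n k r t : ℕ) → 3 ≤ r → 1 ≤ t → 1 ≤ n → 1 ≤ k → 2 * k ≤ n →
    (F : List (Subset n)) → IsKFamily n k F → RWiseTIntersecting r t F →
    (q : ℚ) → 0ℚ < q → q < 1ℚ → 1ℚ + (q ^ℚ r) < q + q →
    ℕ→ℚ (length F) ℚ.≤ (q ^ℚ t) ℚ.* ℕ→ℚ (n C k)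
proposition4p4 n k r t 3≤r@(s≤s _) 1≤t _ _ 2k≤n F (unique , uniform) intersecting q 0<q _ root = begin
  ℕ→ℚ (length F)                              ≤⟨ ℕ→ℚ-mono (length≤walkBound n k t F unique uniform intersecting) ⟩
  ℕ→ℚ (walkBound r n k t)                     ≡⟨ cong ℕ→ℚ (ℕ.+-identityʳ (walkBound r n k t)) ⟨
  ℕ→ℚ (2 ℕ.^ 0 ℕ.* walkBound r n k t)         ≤⟨ walkBound-weighted (ℚ.<⇒≤ 0<q) root 3≤r 1≤t 2k≤n 0 0 n k t refl refl refl ⟩
  q ^ℚ t ℚ.* ℕ→ℚ (n C k)                      ∎
  where open ℚ.≤-Reasoning
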